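{- Let $\mathcal{B}=(\mathcal{V},\mathcal{E})$ be a finite connected undirected graph with an action of a group $G$ by graph automorphisms. Let $\mathcal{W}$ be the set of $G$-pivot vertices in $\mathcal{B}$ and assume $\mathcal{W}\neq\emptyset$. Let $d=\min\{|Gv|\mid v\in\mathcal{W}\}$. Then $|\mathcal{W}|\leq \beta(\mathcal{B})+2d-1$. Furthermore, the number of $G$-orbits in $\mathcal{W}$ is bounded by $\frac{1}{d}(\beta(\mathcal{B})-1)+2$.
   Context: A finite undirected graph $\mathcal{B}$ has a finite vertex set $\mathcal{V}$ and an edge set $\mathcal{E}$ of $2$-element subsets of $\mathcal{V}$. A vertex $v$ is a $G$-pivot vertex if for every $w\in\mathcal{V}$ with $\{v,w\}\in\mathcal{E}$, the set $\{gw\mid g\in G,\ gv=v\}$ has even cardinality. $Gv$ denotes the $G$-orbit of $v$. The Betti number is $\beta(\mathcal{B})=|\mathcal{E}|-|\mathcal{V}|+1$. -}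

module Defs where

open import Level using (Level; _⊔_)
open import Data.Bool using (Bool; true; false; _∧_; if_then_else_)
open import Data.Nat using (ℕ; _<ᵇ_)
open import Data.Nat.Divisibility using (_∣_)
open import Data.Fin using (Fin; toℕ)
open import Data.List using (List; length; map; allFin)
open import Data.Nat.ListAction using (sum)
open import Data.List.Membership.Propositional using (_∈_)
open import Data.List.Relation.Unary.All using (All)
open import Data.List.Relation.Unary.Any using (Any)
open import Data.List.Relation.Unary.AllPairs using (AllPairs)
open import Data.List.Relation.Unary.Unique.Propositional using (Unique)
open import Data.Product using (Σ; ∃; _×_; _,_)
open import Data.Integer using (ℤ; +_; _-_; _+_)
open import Function.Bundles using (_⇔_)
open import Relation.Nullary using (¬_)
open import Relation.Binary.PropositionalEquality using (_≡_)
open import Relation.Binary.Construct.Closure.ReflexiveTransitive using (Star)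
open import Algebra.Bundles using (Group)

record Graph (n : ℕ) : Set where
  field
    adj     : Fin n → Fin n → Bool
    adj-sym : ∀ x y → adj x y ≡ adj y x
    adj-irr : ∀ x → adj x x ≡ false
open Graph public

Adjacent : ∀ {n} → Graph n → Fin n → Fin n → Set
Adjacent B x y = adj B x y ≡ true

edgeCount : ∀ {n} → Graph n → ℕ
edgeCount {n} B =
  sum (map (λ i → sum (map (λ j → if (toℕ i <ᵇ toℕ j) ∧ adj B i j then 1 else 0)
                           (allFin n)))
           (allFin n))

betti : ∀ {n} → Graph n → ℤ
betti {n} B = (+ edgeCount B - + n) + + 1

Connected : ∀ {n} → Graph n → Set
Connected B = ∀ x y → Star (Adjacent B) x y

record GraphAction {c ℓ : Level} (G : Group c ℓ) {n : ℕ} (B : Graph n)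
       : Set (c ⊔ ℓ) where
  open Group G
  field
    act      : Carrier → Fin n → Fin n
    act-ε    : ∀ x → act ε x ≡ x
    act-∙    : ∀ g h x → act (g ∙ h) x ≡ act g (act h x)
    act-cong : ∀ {g h} → g ≈ h → ∀ x → act g x ≡ act h x
    act-adj  : ∀ g x y → adj B (act g x) (act g y) ≡ adj B x y
open GraphAction public

HasCard : ∀ {a} {n : ℕ} → (Fin n → Set a) → ℕ → Set a
HasCard {n = n} P k =
  Σ (List (Fin n)) λ L → Unique L × (∀ x → (x ∈ L) ⇔ P x) × length L ≡ k

module _ {c ℓ : Level} {G : Group c ℓ} {n : ℕ} {B : Graph n}
         (A : GraphAction G B) where
  open Group G

  Orbit : Fin n → Fin n → Set c
  Orbit v x = ∃ λ g → act A g v ≡ x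

  StabOrbit : Fin n → Fin n → Fin n → Set c
  StabOrbit v w x = ∃ λ g → act A g v ≡ v × act A g w ≡ x

  Pivot : Fin n → Set c
  Pivot v = ∀ w → Adjacent B v w →
            ∃ λ k → HasCard (StabOrbit v w) k × 2 ∣ k

  IsMinPivotOrbitSize : ℕ → Set c
  IsMinPivotOrbitSize d =
    (∃ λ v → Pivot v × HasCard (Orbit v) d) ×
    (∀ v → Pivot v → ∀ k → HasCard (Orbit v) k → d Data.Nat.≤ k)

  PivotOrbitCount : ℕ → Set c
  PivotOrbitCount r =
    Σ (List (Fin n)) λ R →
      length R ≡ r × All Pivot R ×
      AllPairs (λ a b → ¬ Orbit a b) R ×
      (∀ v → Pivot v → Any (λ a → Orbit a v) R)

module Submission where

-- Fix a pivot v₀ whose orbit S = G v₀ has the minimal size d.  Use the graph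
-- distance to S as a height; it is G-invariant, and every vertex outside S
-- has a lower neighbour (one strictly closer to S).  Every edge is a lower
-- edge for at most one of its endpoints, so the lower degrees sum to at most
-- |E|.  A pivot y has "twins": the stabiliser of y moves each neighbour z to
-- a different neighbour (the stabiliser orbit of z has even size), which is
-- as close to S as z.  So a pivot outside S has two lower neighbours, and for
-- every duplicate-free list U of vertices with twins, summing
--   1 + [y ∈ U] ≤ lowerDegree(y) + 2 [y ∈ S]
-- over all vertices gives the key inequality |V| + |U| ≤ |E| + 2d.  Part one
-- takes U = all pivots.  Part two takes U = the union of the r pivot orbits,
-- of size at least d r; listing orbits uses decidability of orbit membership,
-- available by double negation since the conclusion is decidable.

open import Defs
open import Level using (Level)
open import Algebra.Bundles using (Group)
open import Data.Nat using (ℕ; zero; suc; _*_)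
open import Data.Fin using (Fin; zero; suc)
open import Data.Bool using (Bool)
open import Data.Product using (∃; _×_; _,_)
open import Data.List using (List)
open import Data.List.Membership.Propositional using (_∈_)
open import Data.List.Relation.Unary.Unique.Propositional using (Unique)
open import Function.Bundles using (_⇔_; Equivalence)
open import Relation.Binary.PropositionalEquality using (refl)
import Data.List.Relation.Unary.All as All
open import Relation.Nullary using (Dec; ¬_)

module FiniteSums where
  open import Data.Nat using (_+_; _≤_; z≤n)
  open import Data.Nat.Properties
    using (+-0-commutativeMonoid; +-mono-≤; +-mono-<; <⇒≱; ≮⇒≥; ≤-reflexive; ≤-trans)
  open import Data.List using (map; tabulate; allFin)
  open import Data.List.Properties using (map-tabulate)
  import Data.Nat.ListAction as ListAction
  open import Relation.Binary.PropositionalEquality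
  open import Function using (_∘_)
  open import Algebra.Properties.CommutativeMonoid.Sum +-0-commutativeMonoid public
    using (sum; sum-syntax; sum-cong-≗; sum-replicate-zero; ∑-distrib-+; ∑-comm)

  ∑-mono : ∀ {n} {f g : Fin n → ℕ} → (∀ i → f i ≤ g i) → sum f ≤ sum g
  ∑-mono {zero} f≤g = z≤n
  ∑-mono {suc n} f≤g = +-mono-≤ (f≤g zero) (∑-mono (f≤g ∘ suc))

  ∑-one : ∀ n → ∑[ i < n ] 1 ≡ n
  ∑-one zero = refl
  ∑-one (suc n) = cong suc (∑-one n)

  listSum-allFin : ∀ {n} (f : Fin n → ℕ) → ListAction.sum (map f (allFin n)) ≡ sum f
  listSum-allFin {n} f = trans (cong ListAction.sum (map-tabulate (λ i → i) f)) (tabulated f)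
    where
    tabulated : ∀ {m} (g : Fin m → ℕ) → ListAction.sum (tabulate g) ≡ sum g
    tabulated {zero} g = refl
    tabulated {suc m} g = cong (g zero +_) (tabulated (g ∘ suc))

  -- A double sum is bounded by another one as soon as this holds for the
  -- symmetrised summands: summing h i j + h j i counts every term of h twice.
  ∑∑-sym-≤ : ∀ {n} (h e : Fin n → Fin n → ℕ) → (∀ i j → h i j + h j i ≤ e i j + e j i) →
             ∑[ i < n ] ∑[ j < n ] h i j ≤ ∑[ i < n ] ∑[ j < n ] e i j
  ∑∑-sym-≤ {n} h e sym≤ = halve twice
    where
    double : (k : Fin n → Fin n → ℕ) →
             ∑[ i < n ] ∑[ j < n ] k i j + ∑[ i < n ] ∑[ j < n ] k i j ≡
             ∑[ i < n ] ∑[ j < n ] (k i j + k j i)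
    double k = begin
        ∑[ i < n ] ∑[ j < n ] k i j + ∑[ i < n ] ∑[ j < n ] k i j
      ≡⟨ cong (∑[ i < n ] ∑[ j < n ] k i j +_) (∑-comm k) ⟩
        ∑[ i < n ] ∑[ j < n ] k i j + ∑[ i < n ] ∑[ j < n ] k j i
      ≡⟨ sym (∑-distrib-+ (λ i → ∑[ j < n ] k i j) (λ i → ∑[ j < n ] k j i)) ⟩
        ∑[ i < n ] (∑[ j < n ] k i j + ∑[ j < n ] k j i)
      ≡⟨ sum-cong-≗ (λ i → sym (∑-distrib-+ (k i) (λ j → k j i))) ⟩
        ∑[ i < n ] ∑[ j < n ] (k i j + k j i) ∎
      where open ≡-Reasoning
    twice : ∑[ i < n ] ∑[ j < n ] h i j + ∑[ i < n ] ∑[ j < n ] h i j ≤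
            ∑[ i < n ] ∑[ j < n ] e i j + ∑[ i < n ] ∑[ j < n ] e i j
    twice = ≤-trans (≤-reflexive (double h))
              (≤-trans (∑-mono (λ i → ∑-mono (sym≤ i)))
                       (≤-reflexive (sym (double e))))
    halve : ∀ {a b} → a + a ≤ b + b → a ≤ b
    halve a+a≤b+b = ≮⇒≥ (λ b<a → <⇒≱ (+-mono-< b<a b<a) a+a≤b+b)

module Indicators where
  open FiniteSums
  open import Data.Bool using (true; false; if_then_else_; _∧_; _∨_)
  open import Data.Nat using (_+_; _≤_; z≤n; s≤s)
  open import Data.Nat.Properties using (≤-refl)
  open import Data.Fin.Properties using (_≟_)
  open import Relation.Nullary using (does)
  open import Relation.Binary.PropositionalEquality

  𝟙 : Bool → ℕ
  𝟙 b = if b then 1 else 0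

  𝟙-mono : ∀ {b c} → (b ≡ true → c ≡ true) → 𝟙 b ≤ 𝟙 c
  𝟙-mono {false} b⇒c = z≤n
  𝟙-mono {true} b⇒c rewrite b⇒c refl = ≤-refl

  𝟙≤1 : ∀ b → 𝟙 b ≤ 1
  𝟙≤1 false = z≤n
  𝟙≤1 true = ≤-refl

  𝟙-exclusive : ∀ a p q → ¬ (p ≡ true × q ≡ true) → 𝟙 (a ∧ p) + 𝟙 (a ∧ q) ≤ 𝟙 a
  𝟙-exclusive false _ _ _ = z≤n
  𝟙-exclusive true false false _ = z≤n
  𝟙-exclusive true false true _ = ≤-refl
  𝟙-exclusive true true false _ = ≤-refl
  𝟙-exclusive true true true excl with () ← excl (refl , refl)

  𝟙-cover : ∀ a s t → (a ≡ true → s ∨ t ≡ true) → 𝟙 a ≤ 𝟙 (s ∧ a) + 𝟙 (t ∧ a)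
  𝟙-cover false _ _ _ = z≤n
  𝟙-cover true true _ _ = s≤s z≤n
  𝟙-cover true false true _ = ≤-refl
  𝟙-cover true false false cover with () ← cover refl

  ∑-point : ∀ {n} (a : Fin n) → ∑[ y < n ] 𝟙 (does (y ≟ a)) ≡ 1
  ∑-point {suc n} zero = cong suc (sum-replicate-zero n)
  ∑-point {suc n} (suc a) = ∑-point a

module Counting {n : ℕ} where
  open FiniteSums
  open Indicators
  open import Data.Bool using (true)
  open import Data.Nat using (_+_; _≤_)
  open import Data.Nat.Properties using (≤-trans; ≤-reflexive)
  open import Data.Fin.Properties using (_≟_)
  open import Data.List using (_∷_; length)
  open import Data.List.Membership.DecPropositional (_≟_ {n}) using (_∈?_)
  open import Data.List.Relation.Unary.All using (All; lookup)
  open import Data.List.Relation.Unary.All.Properties using (All¬⇒¬Any)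
  open import Data.List.Relation.Unary.Unique.Propositional using ([]; _∷_)
  open import Relation.Nullary using (does; yes; no; contradiction)
  open import Relation.Binary.PropositionalEquality

  _∈ᵇ_ : Fin n → List (Fin n) → Bool
  y ∈ᵇ L = does (y ∈? L)

  ∑-members : ∀ {L : List (Fin n)} → Unique L → ∑[ y < n ] 𝟙 (y ∈ᵇ L) ≡ length L
  ∑-members [] = sum-replicate-zero n
  ∑-members {a ∷ L} (a∉L ∷ uniqueL) = begin
      ∑[ y < n ] 𝟙 (y ∈ᵇ (a ∷ L))
    ≡⟨ sum-cong-≗ split ⟩
      ∑[ y < n ] (𝟙 (does (y ≟ a)) + 𝟙 (y ∈ᵇ L))
    ≡⟨ ∑-distrib-+ (λ y → 𝟙 (does (y ≟ a))) (λ y → 𝟙 (y ∈ᵇ L)) ⟩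
      ∑[ y < n ] 𝟙 (does (y ≟ a)) + ∑[ y < n ] 𝟙 (y ∈ᵇ L)
    ≡⟨ cong₂ _+_ (∑-point a) (∑-members uniqueL) ⟩
      suc (length L) ∎
    where
    open ≡-Reasoning
    -- a does not occur in L, so the two indicators never overlap
    split : ∀ y → 𝟙 (y ∈ᵇ (a ∷ L)) ≡ 𝟙 (does (y ≟ a)) + 𝟙 (y ∈ᵇ L)
    split y with y ≟ a | y ∈? L
    ... | yes refl | yes a∈L = contradiction a∈L (All¬⇒¬Any a∉L)
    ... | yes refl | no _ = refl
    ... | no _ | yes _ = refl
    ... | no _ | no _ = refl

  length≤count : (p : Fin n → Bool) {L : List (Fin n)} → Unique L →
                 All (λ x → p x ≡ true) L → length L ≤ ∑[ y < n ] 𝟙 (p y)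
  length≤count p {L} uniqueL pL =
    ≤-trans (≤-reflexive (sym (∑-members uniqueL))) (∑-mono (λ y → 𝟙-mono (member⇒p y)))
    where
    member⇒p : ∀ y → y ∈ᵇ L ≡ true → p y ≡ true
    member⇒p y _  with y ∈? L
    member⇒p y _  | yes y∈L = lookup pL y∈L
    member⇒p y () | no _

-- A duplicate-free list of even length has, besides any given member, a
-- second member.  This is how evenness enters the notion of a pivot vertex.
module EvenLists where
  open import Data.Nat.Divisibility using (_∣_; ∣1⇒≡1)
  open import Data.List using ([]; _∷_; length)
  open import Data.List.Relation.Unary.Any using (here; there)
  open import Data.List.Relation.Unary.All using (_∷_)
  open import Data.List.Relation.Unary.All.Properties using (All¬⇒¬Any)
  open import Data.List.Relation.Unary.Unique.Propositional using (_∷_)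
  open import Relation.Binary.PropositionalEquality using (_≢_; sym)

  another-member : ∀ {a} {X : Set a} {L : List X} {x : X} → Unique L → 2 ∣ length L → x ∈ L →
                   ∃ λ y → y ∈ L × y ≢ x
  another-member {L = p ∷ []} _ 2∣1 _ with () ← ∣1⇒≡1 2∣1
  another-member {L = p ∷ q ∷ L} ((p≢q ∷ _) ∷ _) _ (here refl) =
    q , there (here refl) , λ q≡p → p≢q (sym q≡p)
  another-member {L = p ∷ q ∷ L} (p∉qL ∷ _) _ (there x∈qL) =
    p , here refl , λ { refl → All¬⇒¬Any p∉qL x∈qL }

module ActionFacts {c ℓ : Level} {G : Group c ℓ} {n : ℕ} {B : Graph n}
                   (A : GraphAction G B) where
  open Group G using (_∙_; _⁻¹; ε; inverseˡ; inverseʳ)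
  open import Data.Bool using (true)
  open import Function.Bundles using (mk⇔)
  open import Relation.Binary.PropositionalEquality
  open EvenLists using (another-member)

  act-cancelˡ : ∀ g x → act A (g ⁻¹) (act A g x) ≡ x
  act-cancelˡ g x = begin
    act A (g ⁻¹) (act A g x) ≡⟨ act-∙ A (g ⁻¹) g x ⟨
    act A (g ⁻¹ ∙ g) x       ≡⟨ act-cong A (inverseˡ g) x ⟩
    act A ε x                ≡⟨ act-ε A x ⟩
    x                        ∎
    where open ≡-Reasoning

  act-cancelʳ : ∀ g x → act A g (act A (g ⁻¹) x) ≡ x
  act-cancelʳ g x = begin
    act A g (act A (g ⁻¹) x) ≡⟨ act-∙ A g (g ⁻¹) x ⟨
    act A (g ∙ g ⁻¹) x       ≡⟨ act-cong A (inverseʳ g) x ⟩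
    act A ε x                ≡⟨ act-ε A x ⟩
    x                        ∎
    where open ≡-Reasoning

  act-injective : ∀ g {x y} → act A g x ≡ act A g y → x ≡ y
  act-injective g {x} {y} gx≡gy =
    trans (sym (act-cancelˡ g x)) (trans (cong (act A (g ⁻¹)) gx≡gy) (act-cancelˡ g y))

  -- Orbits are equivalence classes; this combination of symmetry and
  -- transitivity is what separates distinct orbits.
  orbit-common : ∀ {a b v} → Orbit A a v → Orbit A b v → Orbit A b a
  orbit-common {a} {b} {v} (g , ga≡v) (h , hb≡v) = g ⁻¹ ∙ h , (begin
    act A (g ⁻¹ ∙ h) b       ≡⟨ act-∙ A (g ⁻¹) h b ⟩
    act A (g ⁻¹) (act A h b) ≡⟨ cong (act A (g ⁻¹)) (trans hb≡v (sym ga≡v)) ⟩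
    act A (g ⁻¹) (act A g a) ≡⟨ act-cancelˡ g a ⟩
    a                        ∎)
    where open ≡-Reasoning

  orbit-translate : ∀ g {a x} → Orbit A a (act A g x) ⇔ Orbit A a x
  orbit-translate g {a} {x} = mk⇔
    (λ (h , ha≡gx) → g ⁻¹ ∙ h , trans (act-∙ A (g ⁻¹) h a)
                                  (trans (cong (act A (g ⁻¹)) ha≡gx) (act-cancelˡ g x)))
    (λ (h , ha≡x) → g ∙ h , trans (act-∙ A g h a) (cong (act A g) ha≡x))

  HasTwins : Fin n → Set c
  HasTwins v = ∀ w → Adjacent B v w → ∃ λ h → act A h v ≡ v × act A h w ≢ w

  -- At a pivot v, the stabiliser orbit of a neighbour w has even size, so it
  -- contains a vertex other than w.
  pivot⇒twins : ∀ {v} → Pivot A v → HasTwins v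
  pivot⇒twins {v} pivot w v~w with pivot w v~w
  ... | k , (L , uniqueL , L⇔ , refl) , 2∣k
    with another-member uniqueL 2∣k (Equivalence.from (L⇔ w) (ε , act-ε A v , act-ε A w))
  ... | y , y∈L , y≢w with Equivalence.to (L⇔ y) y∈L
  ... | h , hv≡v , hw≡y = h , hv≡v , λ hw≡w → y≢w (trans (sym hw≡y) hw≡w)

  adjacent-pullback : ∀ g {v w} → Adjacent B (act A g v) w → Adjacent B v (act A (g ⁻¹) w)
  adjacent-pullback g {v} {w} gv~w = begin
    adj B v (act A (g ⁻¹) w)                           ≡⟨ cong (λ u → adj B u _) (act-cancelˡ g v) ⟨
    adj B (act A (g ⁻¹) (act A g v)) (act A (g ⁻¹) w)  ≡⟨ act-adj A (g ⁻¹) (act A g v) w ⟩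
    adj B (act A g v) w                                ≡⟨ gv~w ⟩
    true                                               ∎
    where open ≡-Reasoning

  -- Having twins is invariant under the action: conjugate the twin-maker.
  twins-translate : ∀ {v} g → HasTwins v → HasTwins (act A g v)
  twins-translate {v} g twins w gv~w with twins (act A (g ⁻¹) w) (adjacent-pullback g gv~w)
  ... | h , hv≡v , moves = g ∙ (h ∙ g ⁻¹) , fixes , moves′
    where
    conj : ∀ x → act A (g ∙ (h ∙ g ⁻¹)) x ≡ act A g (act A h (act A (g ⁻¹) x))
    conj x = trans (act-∙ A g (h ∙ g ⁻¹) x) (cong (act A g) (act-∙ A h (g ⁻¹) x))
    fixes : act A (g ∙ (h ∙ g ⁻¹)) (act A g v) ≡ act A g v
    fixes = trans (conj _) (cong (act A g) (trans (cong (act A h) (act-cancelˡ g v)) hv≡v))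
    moves′ : act A (g ∙ (h ∙ g ⁻¹)) w ≢ w
    moves′ g′w≡w =
      moves (act-injective g (trans (sym (conj w)) (trans g′w≡w (sym (act-cancelʳ g w)))))

module LeastWitness where
  open import Data.Bool using (true; false)
  open import Data.Nat using (_≤_; _<_; s≤s)
  open import Data.Nat.Properties using (≤-antisym; ≮⇒≥)
  open import Relation.Binary.PropositionalEquality
  open import Function using (_∘_)

  record Least (b : ℕ → Bool) (m : ℕ) : Set where
    field
      holds  : b m ≡ true
      before : ∀ {j} → j < m → b j ≡ false
  open Least public

  least-exists : ∀ (b : ℕ → Bool) k → b k ≡ true → ∃ (Least b)
  least-exists b zero bk = 0 , record { holds = bk ; before = λ () }
  least-exists b (suc k) bk with b 0 in b0
  ... | true = 0 , record { holds = b0 ; before = λ () }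
  ... | false with least-exists (b ∘ suc) k bk
  ... | m , least = suc m , record { holds = holds least ; before = earlier }
    where
    earlier : ∀ {j} → j < suc m → b j ≡ false
    earlier {zero} _ = b0
    earlier {suc j} (s≤s j<m) = before least j<m

  least-≤ : ∀ {b m k} → Least b m → b k ≡ true → m ≤ k
  least-≤ {k = k} least bk = ≮⇒≥ λ k<m → true≢false (trans (sym bk) (before least k<m))
    where
    true≢false : true ≢ false
    true≢false ()

  least-unique : ∀ {b m m′} → Least b m → Least b m′ → m ≡ m′
  least-unique least least′ = ≤-antisym (least-≤ least (holds least′)) (least-≤ least′ (holds least))

  least-cong : ∀ {b b′ m} → (∀ k → b k ≡ b′ k) → Least b m → Least b′ m
  least-cong {m = m} b≗b′ least = record
    { holds  = trans (sym (b≗b′ m)) (holds least)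
    ; before = λ {j} j<m → trans (sym (b≗b′ j)) (before least j<m)
    }

module VertexSearch where
  open import Data.Bool using (true; false; _∨_)
  open import Relation.Binary.PropositionalEquality
  open import Function using (_∘_)

  anyVertex : ∀ {n} → (Fin n → Bool) → Bool
  anyVertex {zero} p = false
  anyVertex {suc n} p = p zero ∨ anyVertex (p ∘ suc)

  anyVertex-intro : ∀ {n} (p : Fin n → Bool) z → p z ≡ true → anyVertex p ≡ true
  anyVertex-intro p zero pz rewrite pz = refl
  anyVertex-intro p (suc z) pz with p zero
  ... | true = refl
  ... | false = anyVertex-intro (p ∘ suc) z pz

  anyVertex-elim : ∀ {n} (p : Fin n → Bool) → anyVertex p ≡ true → ∃ λ z → p z ≡ true
  anyVertex-elim {suc n} p found with p zero in p0
  ... | true = zero , p0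
  ... | false with anyVertex-elim (p ∘ suc) found
  ... | z , pz = suc z , pz

  anyVertex-cong : ∀ {n} {p q : Fin n → Bool} → (∀ z → p z ≡ q z) → anyVertex p ≡ anyVertex q
  anyVertex-cong {zero} p≗q = refl
  anyVertex-cong {suc n} p≗q = cong₂ _∨_ (p≗q zero) (anyVertex-cong (p≗q ∘ suc))

  anyVertex-reindex : ∀ {n} (p : Fin n → Bool) (σ τ : Fin n → Fin n) → (∀ z → σ (τ z) ≡ z) →
                      anyVertex (p ∘ σ) ≡ anyVertex p
  anyVertex-reindex p σ τ στ≗id with anyVertex (p ∘ σ) in lhs | anyVertex p in rhs
  ... | true  | true  = refl
  ... | false | false = refl
  ... | true  | false with anyVertex-elim (p ∘ σ) lhs
  ...   | z , pσz = trans (sym (anyVertex-intro p (σ z) pσz)) rhs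
  anyVertex-reindex p σ τ στ≗id | false | true with anyVertex-elim p rhs
  ...   | z , pz = trans (sym lhs) (anyVertex-intro (p ∘ σ) (τ z) (trans (cong p (στ≗id z)) pz))

module DistanceToSet {n : ℕ} (B : Graph n) (T : Fin n → Bool) where
  open import Data.Bool using (true; false; _∨_; _∧_)
  open import Data.Bool.Properties using (∨-zeroʳ)
  open import Data.Nat using (_<_; s≤s)
  open import Data.Nat.Properties using (≤-refl)
  open import Data.Product using (proj₁; proj₂)
  open import Relation.Binary.PropositionalEquality
  open import Relation.Binary.Construct.Closure.ReflexiveTransitive using (Star; ε; _◅_)
  open LeastWitness
  open VertexSearch

  within : ℕ → Fin n → Bool
  within zero x = T x
  within (suc k) x = within k x ∨ anyVertex (λ z → adj B x z ∧ within k z)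

  within-path : ∀ {x y} → Star (Adjacent B) x y → T y ≡ true → ∃ λ k → within k x ≡ true
  within-path ε Ty = 0 , Ty
  within-path {x} (_◅_ {j = z} x~z path) Ty with within-path path Ty
  ... | k , within-k = suc k , trans (cong (within k x ∨_) step) (∨-zeroʳ _)
    where
    step : anyVertex (λ z′ → adj B x z′ ∧ within k z′) ≡ true
    step = anyVertex-intro (λ z′ → adj B x z′ ∧ within k z′) z (cong₂ _∧_ x~z within-k)

  ∧-split : ∀ {a b} → a ∧ b ≡ true → a ≡ true × b ≡ true
  ∧-split {true} {true} _ = refl , refl

  within-invariant : (σ τ : Fin n → Fin n) → (∀ z → σ (τ z) ≡ z) →
                     (∀ x y → adj B (σ x) (σ y) ≡ adj B x y) → (∀ x → T (σ x) ≡ T x) →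
                     ∀ k x → within k (σ x) ≡ within k x
  within-invariant σ τ στ≗id σ-adj σ-T zero x = σ-T x
  within-invariant σ τ στ≗id σ-adj σ-T (suc k) x =
    cong₂ _∨_ (within-invariant σ τ στ≗id σ-adj σ-T k x) (begin
      anyVertex (λ z → adj B (σ x) z ∧ within k z)
        ≡⟨ anyVertex-reindex _ σ τ στ≗id ⟨
      anyVertex (λ z → adj B (σ x) (σ z) ∧ within k (σ z))
        ≡⟨ anyVertex-cong (λ z → cong₂ _∧_ (σ-adj x z) (within-invariant σ τ στ≗id σ-adj σ-T k z)) ⟩
      anyVertex (λ z → adj B x z ∧ within k z) ∎)
    where open ≡-Reasoning

  module _ (connected : Connected B) {t : Fin n} (Tt : T t ≡ true) where
    dist-least : ∀ x → ∃ (Least (λ k → within k x))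
    dist-least x with within-path (connected x t) Tt
    ... | k , within-k = least-exists _ k within-k

    dist : Fin n → ℕ
    dist x = proj₁ (dist-least x)

    dist-invariant : (σ τ : Fin n → Fin n) → (∀ z → σ (τ z) ≡ z) →
                     (∀ x y → adj B (σ x) (σ y) ≡ adj B x y) → (∀ x → T (σ x) ≡ T x) →
                     ∀ x → dist (σ x) ≡ dist x
    dist-invariant σ τ στ≗id σ-adj σ-T x =
      least-unique (proj₂ (dist-least (σ x)))
        (least-cong (λ k → sym (within-invariant σ τ στ≗id σ-adj σ-T k x)) (proj₂ (dist-least x)))

    descent : ∀ y → T y ≡ false → ∃ λ z → Adjacent B y z × dist z < dist y
    descent y Ty = below (proj₂ (dist-least y))
      where
      below : ∀ {m} → Least (λ k → within k y) m → ∃ λ z → Adjacent B y z × dist z < m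
      below {zero} least with () ← trans (sym Ty) (holds least)
      below {suc m} least with within m y in within-m | holds least
      ... | true  | _ with () ← trans (sym within-m) (before least ≤-refl)
      ... | false | found with anyVertex-elim _ found
      ... | z , found-z with ∧-split found-z
      ... | y~z , within-z = z , y~z , s≤s (least-≤ (proj₂ (dist-least z)) within-z)

-- Lower neighbours with respect to a height function f: a neighbour x of y
-- with f x < f y.  Each edge is a lower edge for at most one endpoint.
module LowerNeighbours {n : ℕ} (B : Graph n) (f : Fin n → ℕ) where
  open FiniteSums
  open Indicators
  open Counting {n}
  open import Data.Bool using (true; _∧_; _∨_)
  open import Data.Bool.Properties using (T-≡; ∨-zeroʳ)
  open import Data.Nat using (_+_; _≤_; _<_; _<ᵇ_)
  open import Data.Nat.Properties using (<-asym; <ᵇ⇒<; <⇒<ᵇ; <-cmp; module ≤-Reasoning)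
  open import Data.Fin using (toℕ)
  open import Data.Fin.Properties using (toℕ-injective)
  open import Data.List using (length; map; allFin)
  import Data.Nat.ListAction as ListAction
  open import Data.List.Relation.Unary.All using (All)
  open import Relation.Binary.Definitions using (tri<; tri≈; tri>)
  open import Relation.Binary.PropositionalEquality

  <ᵇ-complete : ∀ {m k} → m < k → (m <ᵇ k) ≡ true
  <ᵇ-complete m<k = Equivalence.to T-≡ (<⇒<ᵇ m<k)

  <ᵇ-sound : ∀ m k → (m <ᵇ k) ≡ true → m < k
  <ᵇ-sound m k m<ᵇk = <ᵇ⇒< m k (Equivalence.from T-≡ m<ᵇk)

  lower : Fin n → Fin n → Bool
  lower x y = adj B x y ∧ (f x <ᵇ f y)

  lowerDegree : Fin n → ℕ
  lowerDegree y = ∑[ x < n ] 𝟙 (lower x y)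

  ordered : Fin n → Fin n → ℕ
  ordered i j = 𝟙 ((toℕ i <ᵇ toℕ j) ∧ adj B i j)

  edgeCount≡∑∑ : edgeCount B ≡ ∑[ i < n ] ∑[ j < n ] ordered i j
  edgeCount≡∑∑ = trans (listSum-allFin (λ i → ListAction.sum (map (ordered i) (allFin n))))
                       (sum-cong-≗ (λ i → listSum-allFin (ordered i)))

  edge-ordered : ∀ i j → adj B i j ≡ true → (toℕ i <ᵇ toℕ j) ∨ (toℕ j <ᵇ toℕ i) ≡ true
  edge-ordered i j i~j with <-cmp (toℕ i) (toℕ j)
  ... | tri< i<j _ _ = cong (_∨ (toℕ j <ᵇ toℕ i)) (<ᵇ-complete i<j)
  ... | tri> _ _ j<i rewrite <ᵇ-complete j<i = ∨-zeroʳ _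
  ... | tri≈ _ i≡j _ with () ←
    trans (sym i~j) (trans (cong (adj B i) (sym (toℕ-injective i≡j))) (adj-irr B i))

  lower-per-edge : ∀ i j → 𝟙 (lower j i) + 𝟙 (lower i j) ≤ ordered i j + ordered j i
  lower-per-edge i j rewrite adj-sym B j i = begin
    𝟙 (adj B i j ∧ (f j <ᵇ f i)) + 𝟙 (adj B i j ∧ (f i <ᵇ f j))
      ≤⟨ 𝟙-exclusive (adj B i j) (f j <ᵇ f i) (f i <ᵇ f j) not-both ⟩
    𝟙 (adj B i j)
      ≤⟨ 𝟙-cover (adj B i j) (toℕ i <ᵇ toℕ j) (toℕ j <ᵇ toℕ i) (edge-ordered i j) ⟩
    ordered i j + 𝟙 ((toℕ j <ᵇ toℕ i) ∧ adj B i j) ∎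
    where
    open ≤-Reasoning
    not-both : ¬ ((f j <ᵇ f i) ≡ true × (f i <ᵇ f j) ≡ true)
    not-both (j<i , i<j) = <-asym (<ᵇ-sound (f j) (f i) j<i) (<ᵇ-sound (f i) (f j) i<j)

  ∑-lowerDegree≤edgeCount : ∑[ y < n ] lowerDegree y ≤ edgeCount B
  ∑-lowerDegree≤edgeCount = begin
    ∑[ y < n ] ∑[ x < n ] 𝟙 (lower x y)
      ≤⟨ ∑∑-sym-≤ (λ y x → 𝟙 (lower x y)) ordered lower-per-edge ⟩
    ∑[ i < n ] ∑[ j < n ] ordered i j
      ≡⟨ edgeCount≡∑∑ ⟨
    edgeCount B ∎
    where open ≤-Reasoning

  lowerDegree-≥ : ∀ {y} {L : List (Fin n)} → Unique L →
                  All (λ z → Adjacent B y z × f z < f y) L → length L ≤ lowerDegree y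
  lowerDegree-≥ {y} uniqueL lowerL = length≤count (λ x → lower x y) uniqueL
    (All.map (λ (y~z , fz<fy) → cong₂ _∧_ (trans (adj-sym B _ y) y~z) (<ᵇ-complete fz<fy)) lowerL)

module KeyInequality {c ℓ : Level} {G : Group c ℓ} {n : ℕ} {B : Graph n} (A : GraphAction G B)
                     (connected : Connected B) {v₀ : Fin n} {S : List (Fin n)}
                     (uniqueS : Unique S) (S⇔orbit : ∀ x → (x ∈ S) ⇔ Orbit A v₀ x) where
  open Group G using (ε; _⁻¹)
  open FiniteSums
  open Indicators
  open Counting {n}
  open ActionFacts A
  open import Data.Bool using (true; false)
  open import Data.Nat using (_+_; _≤_; _<_; s≤s)
  open import Data.Nat.Properties
    using (+-mono-≤; m≤n+m; ≤-trans; ≤-reflexive; +-identityʳ; module ≤-Reasoning)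
  open import Data.Fin.Properties using (_≟_)
  open import Data.List using (length)
  open import Data.List.Membership.DecPropositional (_≟_ {n}) using (_∈?_)
  open import Data.List.Relation.Unary.All using (All; []; _∷_; lookup)
  open import Data.List.Relation.Unary.Unique.Propositional using ([]; _∷_)
  open import Function.Bundles using (mk⇔)
  open import Relation.Nullary using (yes; no; does)
  open import Function using (_∘_)
  open import Relation.Nullary.Decidable using (does-⇔; dec-true)
  open import Relation.Binary.PropositionalEquality

  inS : Fin n → Bool
  inS x = x ∈ᵇ S

  inS-invariant : ∀ g x → inS (act A g x) ≡ inS x
  inS-invariant g x = does-⇔ (mk⇔ to from) (act A g x ∈? S) (x ∈? S)
    where
    to : act A g x ∈ S → x ∈ S
    to = Equivalence.from (S⇔orbit x) ∘ Equivalence.to (orbit-translate g) ∘ Equivalence.to (S⇔orbit _)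
    from : x ∈ S → act A g x ∈ S
    from = Equivalence.from (S⇔orbit _) ∘ Equivalence.from (orbit-translate g) ∘ Equivalence.to (S⇔orbit x)

  v₀∈S : inS v₀ ≡ true
  v₀∈S = dec-true (v₀ ∈? S) (Equivalence.from (S⇔orbit v₀) (ε , act-ε A v₀))

  open DistanceToSet B inS using (dist; descent; dist-invariant)

  height : Fin n → ℕ
  height = dist connected v₀∈S

  height-invariant : ∀ g x → height (act A g x) ≡ height x
  height-invariant g =
    dist-invariant connected v₀∈S (act A g) (act A (g ⁻¹)) (act-cancelʳ g) (act-adj A g) (inS-invariant g)

  open LowerNeighbours B height

  one-lower : ∀ y → inS y ≡ false → 1 ≤ lowerDegree y
  one-lower y y∉S with descent connected v₀∈S y y∉S
  ... | z , y~z , closer = lowerDegree-≥ ([] ∷ []) ((y~z , closer) ∷ [])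

  -- The twin h z of a lower neighbour z is another lower neighbour.
  two-lower : ∀ y → inS y ≡ false → HasTwins y → 2 ≤ lowerDegree y
  two-lower y y∉S twins with descent connected v₀∈S y y∉S
  ... | z , y~z , closer with twins z y~z
  ... | h , hy≡y , hz≢z =
    lowerDegree-≥ (((λ z≡hz → hz≢z (sym z≡hz)) ∷ []) ∷ [] ∷ [])
                  ((y~z , closer) ∷ (y~hz , closer′) ∷ [])
    where
    y~hz : Adjacent B y (act A h z)
    y~hz = trans (cong (λ u → adj B u (act A h z)) (sym hy≡y)) (trans (act-adj A h y z) y~z)
    closer′ : height (act A h z) < height y
    closer′ = subst (_< height y) (sym (height-invariant h z)) closer

  -- The pointwise inequality: vertices in S are paid for by the term 2 [y ∈ S].
  pointwise : ∀ {U} → All HasTwins U → ∀ y →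
              1 + 𝟙 (y ∈ᵇ U) ≤ lowerDegree y + (𝟙 (inS y) + 𝟙 (inS y))
  pointwise {U} twinsU y with inS y in inS-y | y ∈? U
  ... | true  | y∈U? = ≤-trans (s≤s (𝟙≤1 (does y∈U?))) (m≤n+m 2 (lowerDegree y))
  ... | false | yes y∈U =
    ≤-trans (two-lower y inS-y (lookup twinsU y∈U)) (≤-reflexive (sym (+-identityʳ _)))
  ... | false | no _ = ≤-trans (one-lower y inS-y) (≤-reflexive (sym (+-identityʳ _)))

  key-inequality : ∀ {U} → Unique U → All HasTwins U → n + length U ≤ edgeCount B + 2 * length S
  key-inequality {U} uniqueU twinsU = begin
    n + length U
      ≡⟨ cong₂ _+_ (∑-one n) (∑-members uniqueU) ⟨
    ∑[ y < n ] 1 + ∑[ y < n ] 𝟙 (y ∈ᵇ U)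
      ≡⟨ ∑-distrib-+ (λ _ → 1) (λ y → 𝟙 (y ∈ᵇ U)) ⟨
    ∑[ y < n ] (1 + 𝟙 (y ∈ᵇ U))
      ≤⟨ ∑-mono (pointwise twinsU) ⟩
    ∑[ y < n ] (lowerDegree y + (𝟙 (inS y) + 𝟙 (inS y)))
      ≡⟨ trans (∑-distrib-+ lowerDegree _)
               (cong (∑[ y < n ] lowerDegree y +_) (∑-distrib-+ (𝟙 ∘ inS) (𝟙 ∘ inS))) ⟩
    ∑[ y < n ] lowerDegree y + (∑[ y < n ] 𝟙 (inS y) + ∑[ y < n ] 𝟙 (inS y))
      ≤⟨ +-mono-≤ ∑-lowerDegree≤edgeCount
                  (≤-reflexive (cong₂ _+_ (∑-members uniqueS) (∑-members uniqueS))) ⟩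
    edgeCount B + (length S + length S)
      ≡⟨ cong (λ s → edgeCount B + (length S + s)) (+-identityʳ (length S)) ⟨
    edgeCount B + 2 * length S ∎
    where open ≤-Reasoning

module OrbitUnion {c ℓ : Level} {G : Group c ℓ} {n : ℕ} {B : Graph n} (A : GraphAction G B)
                  (orbit? : ∀ a x → Dec (Orbit A a x)) where
  open ActionFacts A
  open import Data.Nat using (_+_; _≤_)
  open import Data.Nat.Properties using (≤-reflexive; *-zeroʳ; *-suc; +-mono-≤; module ≤-Reasoning)
  open import Data.List using ([]; _∷_; _++_; length; filter; allFin)
  open import Data.List.Properties using (length-++)
  open import Data.List.Membership.Propositional.Properties using (∈-filter⁺; ∈-filter⁻; ∈-allFin; ∈-++⁻)
  open import Data.List.Relation.Unary.All using (All; []; _∷_; lookup)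
  open import Data.List.Relation.Unary.AllPairs using (AllPairs; []; _∷_)
  open import Data.List.Relation.Unary.Any using (here; there)
  open import Data.List.Relation.Unary.Unique.Propositional.Properties using (++⁺; filter⁺; allFin⁺)
  open import Data.Product using (proj₂)
  open import Data.Sum using (inj₁; inj₂)
  open import Function.Bundles using (mk⇔)
  open import Relation.Binary.PropositionalEquality using (subst)

  orbitList : Fin n → List (Fin n)
  orbitList a = filter (orbit? a) (allFin n)

  orbitList-unique : ∀ a → Unique (orbitList a)
  orbitList-unique a = filter⁺ (orbit? a) (allFin⁺ n)

  orbitList⇔ : ∀ a x → (x ∈ orbitList a) ⇔ Orbit A a x
  orbitList⇔ a x = mk⇔ (λ x∈ → proj₂ (∈-filter⁻ (orbit? a) {xs = allFin n} x∈))
                       (∈-filter⁺ (orbit? a) (∈-allFin x))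

  union : List (Fin n) → List (Fin n)
  union [] = []
  union (a ∷ R) = orbitList a ++ union R

  union-member : ∀ R {x} → x ∈ union R → ∃ λ b → b ∈ R × Orbit A b x
  union-member (a ∷ R) x∈ with ∈-++⁻ (orbitList a) x∈
  ... | inj₁ x∈a = a , here refl , Equivalence.to (orbitList⇔ a _) x∈a
  ... | inj₂ x∈R with union-member R x∈R
  ...   | b , b∈R , orbit-b = b , there b∈R , orbit-b

  union-unique : ∀ {R} → AllPairs (λ a b → ¬ Orbit A a b) R → Unique (union R)
  union-unique [] = []
  union-unique {a ∷ R} (separated ∷ separatedR) =
    ++⁺ (orbitList-unique a) (union-unique separatedR) λ (x∈a , x∈R) →
      let b , b∈R , orbit-b = union-member R x∈R
      in lookup separated b∈R (orbit-common orbit-b (Equivalence.to (orbitList⇔ a _) x∈a))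

  union-twins : ∀ {R} → All (Pivot A) R → All HasTwins (union R)
  union-twins {R} pivots = All.tabulate λ x∈ →
    let b , b∈R , (g , gb≡x) = union-member R x∈
    in subst HasTwins gb≡x (twins-translate g (pivot⇒twins (lookup pivots b∈R)))

  union-length : ∀ {d} → (∀ v → Pivot A v → ∀ k → HasCard (Orbit A v) k → d ≤ k) →
                 ∀ {R} → All (Pivot A) R → d * length R ≤ length (union R)
  union-length {d} minimal [] = ≤-reflexive (*-zeroʳ d)
  union-length {d} minimal {a ∷ R} (pivot ∷ pivots) = begin
    d * suc (length R)                  ≡⟨ *-suc d (length R) ⟩
    d + d * length R                    ≤⟨ +-mono-≤ orbit-a (union-length minimal pivots) ⟩
    length (orbitList a) + length (union R) ≡⟨ length-++ (orbitList a) ⟨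
    length (union (a ∷ R))              ∎
    where
    open ≤-Reasoning
    orbit-a : d ≤ length (orbitList a)
    orbit-a = minimal a pivot _ (orbitList a , orbitList-unique a , orbitList⇔ a , refl)

¬¬-∀-Fin : ∀ {p} {m} {P : Fin m → Set p} → (∀ x → ¬ ¬ P x) → ¬ ¬ (∀ x → P x)
¬¬-∀-Fin {m = zero} _ not-all = not-all (λ ())
¬¬-∀-Fin {m = suc m} each not-all =
  each zero λ P0 → ¬¬-∀-Fin (λ x → each (suc x)) λ Psuc →
    not-all λ { zero → P0 ; (suc x) → Psuc x }

-- Listing the orbits needs
-- orbit membership to be decidable, which holds classically; as the
-- conclusion is a decidable inequality, double negation can be removed.
module OrbitCount {c ℓ : Level} {G : Group c ℓ} {n : ℕ} {B : Graph n} (A : GraphAction G B)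
                  (connected : Connected B) {v₀ : Fin n} {S : List (Fin n)}
                  (uniqueS : Unique S) (S⇔orbit : ∀ x → (x ∈ S) ⇔ Orbit A v₀ x) where
  open KeyInequality A connected uniqueS S⇔orbit using (key-inequality)
  open import Data.Nat using (_+_; _≤_; _≤?_)
  open import Data.Nat.Properties using (≤-trans; +-monoʳ-≤)
  open import Data.List using (length)
  open import Data.List.Relation.Unary.All using (All)
  open import Data.List.Relation.Unary.AllPairs using (AllPairs)
  open import Relation.Nullary.Decidable using (decidable-stable; ¬¬-excluded-middle)

  orbits-decidable : ¬ ¬ (∀ a x → Dec (Orbit A a x))
  orbits-decidable = ¬¬-∀-Fin λ a → ¬¬-∀-Fin λ x → ¬¬-excluded-middle

  orbit-count-bound : ∀ {d} → (∀ v → Pivot A v → ∀ k → HasCard (Orbit A v) k → d ≤ k) →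
                      ∀ {R} → All (Pivot A) R → AllPairs (λ a b → ¬ Orbit A a b) R →
                      n + d * length R ≤ edgeCount B + 2 * length S
  orbit-count-bound {d} minimal {R} pivots separated =
    decidable-stable (_ ≤? _) λ fails → orbits-decidable λ orbit? →
      let open OrbitUnion A orbit? in
      fails (≤-trans (+-monoʳ-≤ n (union-length minimal pivots))
                     (key-inequality (union-unique separated) (union-twins pivots)))

module BettiBounds {n : ℕ} (B : Graph n) where
  open import Data.Integer using (+_; _+_; _-_; _≤_; +≤+)
  open import Data.Integer.Properties using (m-n≡m⊖n; ⊖-≥; pos-+)
  open import Data.Integer.Solver using (module +-*-Solver)
  import Data.Nat as ℕ
  import Data.Nat.Properties as ℕ
  open import Relation.Binary.PropositionalEquality

  gap-bound : ∀ {x m} → n ℕ.+ x ℕ.≤ m → + x ≤ + m - + n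
  gap-bound {x} {m} n+x≤m =
    subst (+ x ≤_) (sym (trans (m-n≡m⊖n m n) (⊖-≥ (ℕ.m+n≤o⇒m≤o n n+x≤m))))
          (+≤+ (ℕ.m+n≤o⇒m≤o∸n x (subst (ℕ._≤ m) (ℕ.+-comm n x) n+x≤m)))

  first-form : ∀ D → (betti B + + D) - + 1 ≡ + (edgeCount B ℕ.+ D) - + n
  first-form D = trans
    (solve 3 (λ e v d → ((e :- v) :+ con (+ 1) :+ d) :- con (+ 1) := (e :+ d) :- v)
           refl (+ edgeCount B) (+ n) (+ D))
    (cong (_- + n) (sym (pos-+ (edgeCount B) D)))
    where open +-*-Solver

  second-form : ∀ D → (betti B - + 1) + + D ≡ + (edgeCount B ℕ.+ D) - + n
  second-form D = trans
    (solve 3 (λ e v d → ((e :- v) :+ con (+ 1) :- con (+ 1)) :+ d := (e :+ d) :- v)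
           refl (+ edgeCount B) (+ n) (+ D))
    (cong (_- + n) (sym (pos-+ (edgeCount B) D)))
    where open +-*-Solver

  betti-bound₁ : ∀ {x D} → n ℕ.+ x ℕ.≤ edgeCount B ℕ.+ D → + x ≤ (betti B + + D) - + 1
  betti-bound₁ {D = D} bound = subst (+ _ ≤_) (sym (first-form D)) (gap-bound bound)

  betti-bound₂ : ∀ {x D} → n ℕ.+ x ℕ.≤ edgeCount B ℕ.+ D → + x ≤ (betti B - + 1) + + D
  betti-bound₂ {D = D} bound = subst (+ _ ≤_) (sym (second-form D)) (gap-bound bound)

open import Data.Integer using (+_; _+_; _-_; _≤_)

theorem3p4 : ∀ {c ℓ : Level} (G : Group c ℓ) {n : ℕ} (B : Graph n) (A : GraphAction G B) →
    Connected B →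
    ∃ (Pivot A) →
    (d : ℕ) → IsMinPivotOrbitSize A d →
    (w : ℕ) → HasCard (Pivot A) w →
    (r : ℕ) → PivotOrbitCount A r →
    (+ w ≤ ((betti B + + (2 * d)) - + 1)) ×
    (+ (d * r) ≤ ((betti B - + 1) + + (2 * d)))
theorem3p4 G B A connected _ d ((v₀ , _ , S , uniqueS , S⇔orbit , refl) , minimal)
           w (W , uniqueW , W⇔pivot , refl) r (R , refl , pivotsR , separatedR , _) =
  betti-bound₁ (key-inequality uniqueW twinsW) ,
  betti-bound₂ (orbit-count-bound minimal pivotsR separatedR)
  where
  open ActionFacts A using (HasTwins; pivot⇒twins)
  open KeyInequality A connected uniqueS S⇔orbit using (key-inequality)
  open OrbitCount A connected uniqueS S⇔orbit using (orbit-count-bound)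
  open BettiBounds B using (betti-bound₁; betti-bound₂)

  twinsW : All.All HasTwins W
  twinsW = All.tabulate λ {x} x∈W → pivot⇒twins (Equivalence.to (W⇔pivot x) x∈W)
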